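{- Let $\mathcal F$ be an $m\times n$ Ferrers diagram which is a proper combination of Ferrers diagrams $\mathcal F_1\subseteq[m_1]\times[n_1]$ and $\mathcal F_2\subseteq[m_2]\times[n_2]$ on the injections $\phi_1,\phi_2$. Then for each $l\in\{1,2\}$, either $\mathcal F_l$ keeps its shape in $\mathcal F$ (possibly transposed), or $\mathcal F_l$ degenerates into a single row or column of $\mathcal F$.
   Context: $[a]$ denotes $\{0,1,\dots,a-1\}$. An $m\times n$ Ferrers diagram is a set $\mathcal F\subseteq[m]\times[n]$ of cells ("dots") such that: if $(i,j)\in\mathcal F$, $i\ge1$ then $(i-1,j)\in\mathcal F$; if $(i,j)\in\mathcal F$, $j\le n-2$ then $(i,j+1)\in\mathcal F$; row $0$ has $n$ dots and column $n-1$ has $m$ dots. $\mathcal F$ is a proper combination of $\mathcal F_1$ and $\mathcal F_2$ on injections $\phi_l:\mathcal F_l\to\mathcal F$ ($l=1,2$) if $\phi_1(\mathcal F_1)\cap\phi_2(\mathcal F_2)=\varnothing$, $|\mathcal F_1|+|\mathcal F_2|=|\mathcal F|$, and for each $l$ and any two distinct cells $(i_1,j_1),(i_2,j_2)\in\mathcal F_l$ with $i_1=i_2$ or $j_1=j_2$, the images $\phi_l(i_1,j_1)=(i_1',j_1')$ and $\phi_l(i_2,j_2)=(i_2',j_2')$ satisfy $i_1'=i_2'$ or $j_1'=j_2'$. "$\mathcal F_l$ keeps its shape (possibly transposed)" means: there exist maps $\alpha:[m_l]\to[m]$, $\beta:[n_l]\to[n]$ with $\phi_l(i,j)=(\alpha(i),\beta(j))$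 for all $(i,j)\in\mathcal F_l$, or there exist maps $\alpha:[m_l]\to[n]$, $\beta:[n_l]\to[m]$ with $\phi_l(i,j)=(\beta(j),\alpha(i))$ for all $(i,j)\in\mathcal F_l$. "$\mathcal F_l$ degenerates into a single row or column" means $\phi_l(\mathcal F_l)$ is contained in a single row or in a single column of $[m]\times[n]$. -}

module Defs where

open import Data.Nat using (ℕ; zero; suc; _+_; _∸_)
open import Data.Fin using (Fin; toℕ)
open import Data.Bool using (Bool; true; false; T; if_then_else_)
open import Data.Product using (Σ; Σ-syntax; ∃; ∃-syntax; _×_; _,_; proj₁; proj₂)
open import Data.Sum using (_⊎_)
open import Relation.Binary.PropositionalEquality using (_≡_; _≢_)
open import Function.Definitions using (Injective)

sumFin : (k : ℕ) → (Fin k → ℕ) → ℕ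
sumFin zero    f = 0
sumFin (suc k) f = f Fin.zero + sumFin k (λ i → f (Fin.suc i))

record Ferrers (m n : ℕ) : Set where
  field
    dot  : Fin m → Fin n → Bool
    up   : ∀ (i i' : Fin m) (j : Fin n) → toℕ i ≡ suc (toℕ i') →
           T (dot i j) → T (dot i' j)
    right : ∀ (i : Fin m) (j j' : Fin n) → toℕ j' ≡ suc (toℕ j) →
           T (dot i j) → T (dot i j')
    row0 : ∀ (j : Fin n) → Σ[ i ∈ Fin m ] (toℕ i ≡ 0 × T (dot i j))
    colLast : ∀ (i : Fin m) → Σ[ j ∈ Fin n ] (toℕ j ≡ n ∸ 1 × T (dot i j))

open Ferrers public

Cell : ∀ {m n} → Ferrers m n → Set
Cell {m} {n} F = Σ[ c ∈ (Fin m × Fin n) ] T (dot F (proj₁ c) (proj₂ c))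

row : ∀ {m n} {F : Ferrers m n} → Cell F → Fin m
row ((i , _) , _) = i

col : ∀ {m n} {F : Ferrers m n} → Cell F → Fin n
col ((_ , j) , _) = j

size : ∀ {m n} → Ferrers m n → ℕ
size {m} {n} F = sumFin m (λ i → sumFin n (λ j → if dot F i j then 1 else 0))

CellMap : ∀ {m n ml nl} → Ferrers ml nl → Ferrers m n → Set
CellMap Fl F = Cell Fl → Cell F

PreservesLines : ∀ {m n ml nl} (Fl : Ferrers ml nl) (F : Ferrers m n) →
                 CellMap Fl F → Set
PreservesLines Fl F φ =
  ∀ (a b : Cell Fl) → proj₁ a ≢ proj₁ b →
  (row {F = Fl} a ≡ row {F = Fl} b ⊎ col {F = Fl} a ≡ col {F = Fl} b) →
  (row {F = F} (φ a) ≡ row {F = F} (φ b) ⊎ col {F = F} (φ a) ≡ col {F = F} (φ b))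

record ProperCombination {m n m₁ n₁ m₂ n₂ : ℕ}
    (F : Ferrers m n) (F₁ : Ferrers m₁ n₁) (F₂ : Ferrers m₂ n₂)
    (φ₁ : CellMap F₁ F) (φ₂ : CellMap F₂ F) : Set where
  field
    inj₁      : Injective _≡_ _≡_ φ₁
    inj₂      : Injective _≡_ _≡_ φ₂
    disjoint  : ∀ (a : Cell F₁) (b : Cell F₂) → proj₁ (φ₁ a) ≢ proj₁ (φ₂ b)
    sizes     : size F₁ + size F₂ ≡ size F
    lines₁    : PreservesLines F₁ F φ₁
    lines₂    : PreservesLines F₂ F φ₂

KeepsShape : ∀ {m n ml nl} (Fl : Ferrers ml nl) (F : Ferrers m n) →
             CellMap Fl F → Set
KeepsShape {m} {n} {ml} {nl} Fl F φ =
  (Σ[ α ∈ (Fin ml → Fin m) ] Σ[ β ∈ (Fin nl → Fin n) ]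
     (∀ (a : Cell Fl) → proj₁ (φ a) ≡ (α (row {F = Fl} a) , β (col {F = Fl} a))))
  ⊎
  (Σ[ α ∈ (Fin ml → Fin n) ] Σ[ β ∈ (Fin nl → Fin m) ]
     (∀ (a : Cell Fl) → proj₁ (φ a) ≡ (β (col {F = Fl} a) , α (row {F = Fl} a))))

Degenerates : ∀ {m n ml nl} (Fl : Ferrers ml nl) (F : Ferrers m n) →
              CellMap Fl F → Set
Degenerates {m} {n} Fl F φ =
  (Σ[ r ∈ Fin m ] (∀ (a : Cell Fl) → row {F = F} (φ a) ≡ r))
  ⊎
  (Σ[ c ∈ Fin n ] (∀ (a : Cell Fl) → col {F = F} (φ a) ≡ c))

-- Only injectivity and the line condition on φ matter. The top row of F_l is pairwise
-- collinear, so its image lies in a single row or a single column of F, and likewise for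
-- the last column. For a cell a = (i , j) the cells (0 , j), (0 , n_l - 1), (i , n_l - 1), a
-- form a rectangle of collinear pairs, and in a grid an injective image of such a
-- rectangle has parallel opposite sides. So the row and column of φ a are those of the
-- images of the ends of its row and column; the four combinations of orientations of the
-- two borders give the two shapes and the two degenerations.
module Submission where

open import Defs
open import Data.Nat using (ℕ; zero; suc)
import Data.Nat.Properties as ℕ
open import Data.Fin using (Fin; toℕ; fromℕ) renaming (zero to fzero; suc to fsuc)
import Data.Fin.Properties as Fin
open import Data.Fin.Properties using (toℕ-injective; toℕ-fromℕ; 0≢1+n)
open import Data.Bool.Properties using (T-irrelevant)
open import Data.Product using (_×_; _,_; proj₁; proj₂)
open import Data.Product.Properties using (≡-dec)
open import Data.Sum using (_⊎_; inj₁; inj₂; swap)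
open import Function using (_∘_)
open import Function.Definitions using (Injective)
open import Relation.Nullary using (Dec; yes; no; contradiction)
open import Relation.Binary.PropositionalEquality

-- a b c d in cyclic order; the first two cases are rectangles collapsed onto a segment.
data RectangleShape {A : Set} (a b c d : A) : Set where
  collapsed-ab : a ≡ b → d ≡ c → RectangleShape a b c d
  collapsed-ad : a ≡ d → b ≡ c → RectangleShape a b c d
  proper       : a ≢ b → c ≢ b → a ≢ c → b ≢ d → RectangleShape a b c d

module _ {A : Set} {a b c d : A} where

  shape-flip : RectangleShape a b c d → RectangleShape c b a d
  shape-flip (collapsed-ab a≡b d≡c)   = collapsed-ad (sym d≡c) (sym a≡b)
  shape-flip (collapsed-ad a≡d b≡c)   = collapsed-ab (sym b≡c) (sym a≡d)
  shape-flip (proper a≢b c≢b a≢c b≢d) = proper c≢b a≢b (a≢c ∘ sym) b≢d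

  shape-map : ∀ {B : Set} {f : A → B} → Injective _≡_ _≡_ f →
              RectangleShape a b c d → RectangleShape (f a) (f b) (f c) (f d)
  shape-map {f = f} _ (collapsed-ab a≡b d≡c) = collapsed-ab (cong f a≡b) (cong f d≡c)
  shape-map {f = f} _ (collapsed-ad a≡d b≡c) = collapsed-ad (cong f a≡d) (cong f b≡c)
  shape-map f-inj (proper a≢b c≢b a≢c b≢d) =
    proper (a≢b ∘ f-inj) (c≢b ∘ f-inj) (a≢c ∘ f-inj) (b≢d ∘ f-inj)

module RowGeometry {P R C : Set} (rowOf : P → R) (colOf : P → C)
  (coordinates-injective : ∀ {x y} → rowOf x ≡ rowOf y → colOf x ≡ colOf y → x ≡ y)
  where

  Collinear : P → P → Set
  Collinear x y = rowOf x ≡ rowOf y ⊎ colOf x ≡ colOf y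

  collinear-sym : ∀ {x y} → Collinear x y → Collinear y x
  collinear-sym (inj₁ e) = inj₁ (sym e)
  collinear-sym (inj₂ e) = inj₂ (sym e)

  OnOneRow : ∀ {I : Set} → (I → P) → Set
  OnOneRow f = ∀ i j → rowOf (f i) ≡ rowOf (f j)

  collinear-with-row-pair : ∀ {x y z} → x ≢ y → rowOf x ≡ rowOf y →
                            Collinear x z → Collinear y z → rowOf z ≡ rowOf y
  collinear-with-row-pair _ _ _ (inj₁ y∼z) = sym y∼z
  collinear-with-row-pair _ x∼y (inj₁ x∼z) (inj₂ _) = trans (sym x∼z) x∼y
  collinear-with-row-pair x≢y x∼y (inj₂ x∼z) (inj₂ y∼z) =
    contradiction (coordinates-injective x∼y (trans x∼z (sym y∼z))) x≢y

  record Rectangle (a b c d : P) : Set where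
    field
      shape : RectangleShape a b c d
      ab    : Collinear a b
      bc    : Collinear b c
      cd    : Collinear c d
      da    : Collinear d a

  rectangle-flip : ∀ {a b c d} → Rectangle a b c d → Rectangle c b a d
  rectangle-flip R = record
    { shape = shape-flip shape
    ; ab    = collinear-sym bc
    ; bc    = collinear-sym ab
    ; cd    = collinear-sym da
    ; da    = collinear-sym cd
    }
    where open Rectangle R

  opposite-sides-on-rows : ∀ {a b c d} → Rectangle a b c d →
                           rowOf a ≡ rowOf b → rowOf d ≡ rowOf c
  opposite-sides-on-rows R = go shape bc cd da
    where
    open Rectangle R
    go : ∀ {a b c d} → RectangleShape a b c d →
         Collinear b c → Collinear c d → Collinear d a →
         rowOf a ≡ rowOf b → rowOf d ≡ rowOf c
    go (collapsed-ab _ d≡c) _ _ _ _ = cong rowOf d≡c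
    go (collapsed-ad a≡d b≡c) _ _ _ a∼b =
      trans (cong rowOf (sym a≡d)) (trans a∼b (cong rowOf b≡c))
    go (proper _ _ _ _) _ (inj₁ c∼d) _ _ = sym c∼d
    go (proper _ _ _ _) (inj₁ b∼c) (inj₂ _) (inj₁ d∼a) a∼b = trans d∼a (trans a∼b b∼c)
    go (proper _ _ a≢c _) (inj₁ b∼c) (inj₂ c∼d) (inj₂ d∼a) a∼b =
      contradiction (coordinates-injective (trans a∼b b∼c) (trans (sym d∼a) (sym c∼d))) a≢c
    go (proper _ _ _ b≢d) (inj₂ b∼c) (inj₂ c∼d) (inj₁ d∼a) a∼b =
      contradiction (coordinates-injective (trans (sym a∼b) (sym d∼a)) (trans b∼c c∼d)) b≢d
    go (proper a≢b _ _ _) (inj₂ b∼c) (inj₂ c∼d) (inj₂ d∼a) a∼b =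
      contradiction
        (coordinates-injective a∼b (trans (sym d∼a) (trans (sym c∼d) (sym b∼c)))) a≢b

module Grid {P R C : Set} (rowOf : P → R) (colOf : P → C)
  (coordinates-injective : ∀ {x y} → rowOf x ≡ rowOf y → colOf x ≡ colOf y → x ≡ y)
  where

  open RowGeometry rowOf colOf coordinates-injective public
  module ᵀ = RowGeometry colOf rowOf (λ c r → coordinates-injective r c)

  rectangle-transpose : ∀ {a b c d} → Rectangle a b c d → ᵀ.Rectangle a b c d
  rectangle-transpose R = record
    { shape = shape ; ab = swap ab ; bc = swap bc ; cd = swap cd ; da = swap da }
    where open Rectangle R

  collinear-family-on-line : ∀ {k} (f : Fin (suc k) → P) → Injective _≡_ _≡_ f →
                             (∀ i j → Collinear (f i) (f j)) → OnOneRow f ⊎ ᵀ.OnOneRow f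
  collinear-family-on-line {zero} f _ _ = inj₁ λ { fzero fzero → refl }
  collinear-family-on-line {suc _} f f-inj collinear = on-line (collinear (fsuc fzero) fzero)
    where
    f₁≢f₀ : f (fsuc fzero) ≢ f fzero
    f₁≢f₀ e = 0≢1+n (sym (f-inj e))

    on-line : Collinear (f (fsuc fzero)) (f fzero) → OnOneRow f ⊎ ᵀ.OnOneRow f
    on-line (inj₁ same-row) = inj₁ λ i j → trans (on-row i) (sym (on-row j))
      where
      on-row : ∀ i → rowOf (f i) ≡ rowOf (f fzero)
      on-row i = collinear-with-row-pair f₁≢f₀ same-row (collinear _ i) (collinear _ i)
    on-line (inj₂ same-col) = inj₂ λ i j → trans (on-col i) (sym (on-col j))
      where
      on-col : ∀ i → colOf (f i) ≡ colOf (f fzero)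
      on-col i = ᵀ.collinear-with-row-pair f₁≢f₀ same-col
                   (swap (collinear _ i)) (swap (collinear _ i))

cell-injective : ∀ {m n} {G : Ferrers m n} {a b : Cell G} →
                 row {F = G} a ≡ row {F = G} b → col {F = G} a ≡ col {F = G} b → a ≡ b
cell-injective {a = c , x} {b = .c , y} refl refl = cong (c ,_) (T-irrelevant x y)

module Cells {m n : ℕ} (G : Ferrers m n) = Grid (row {F = G}) (col {F = G}) (cell-injective {G = G})

module Image {ml nl m n : ℕ} (Fl : Ferrers ml nl) (F : Ferrers m n) (φ : CellMap Fl F)
  (φ-injective : Injective _≡_ _≡_ φ) (φ-lines : PreservesLines Fl F φ)
  where

  private
    module S = Cells Fl
    module T = Cells F

  image-collinear : ∀ {a b} → S.Collinear a b → T.Collinear (φ a) (φ b)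
  image-collinear {a} {b} a∼b with ≡-dec Fin._≟_ Fin._≟_ (proj₁ a) (proj₁ b)
  ... | yes same =
    inj₁ (cong (row {F = F} ∘ φ) (cell-injective {G = Fl} (cong proj₁ same) (cong proj₂ same)))
  ... | no distinct = φ-lines a b distinct a∼b

  image-rectangle : ∀ {a b c d} → S.Rectangle a b c d → T.Rectangle (φ a) (φ b) (φ c) (φ d)
  image-rectangle R = record
    { shape = shape-map φ-injective shape
    ; ab    = image-collinear ab
    ; bc    = image-collinear bc
    ; cd    = image-collinear cd
    ; da    = image-collinear da
    }
    where open S.Rectangle R

module Border {m' n' : ℕ} (G : Ferrers (suc m') (suc n')) where

  open Cells G

  rowℕ colℕ : Cell G → ℕ
  rowℕ = toℕ ∘ row {F = G}
  colℕ = toℕ ∘ col {F = G}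

  cell-≡ : ∀ {a b} → rowℕ a ≡ rowℕ b → colℕ a ≡ colℕ b → a ≡ b
  cell-≡ r≡ c≡ = cell-injective {G = G} (toℕ-injective r≡) (toℕ-injective c≡)

  top : Fin (suc n') → Cell G
  top j = (proj₁ (row0 G j) , j) , proj₂ (proj₂ (row0 G j))

  rightmost : Fin (suc m') → Cell G
  rightmost i = (i , proj₁ (colLast G i)) , proj₂ (proj₂ (colLast G i))

  corner : Cell G
  corner = top (fromℕ n')

  top-row : ∀ j → rowℕ (top j) ≡ 0
  top-row j = proj₁ (proj₂ (row0 G j))

  rightmost-col : ∀ i → colℕ (rightmost i) ≡ n'
  rightmost-col i = proj₁ (proj₂ (colLast G i))

  rightmost-zero≡corner : rightmost fzero ≡ corner
  rightmost-zero≡corner = cell-≡ (sym (top-row _)) (trans (rightmost-col _) (sym (toℕ-fromℕ n')))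

  top-injective : Injective _≡_ _≡_ top
  top-injective = cong (col {F = G})

  rightmost-injective : Injective _≡_ _≡_ rightmost
  rightmost-injective = cong (row {F = G})

  top-collinear : ∀ j j' → Collinear (top j) (top j')
  top-collinear j j' = inj₁ (toℕ-injective (trans (top-row j) (sym (top-row j'))))

  rightmost-collinear : ∀ i i' → Collinear (rightmost i) (rightmost i')
  rightmost-collinear i i' = inj₂ (toℕ-injective (trans (rightmost-col i) (sym (rightmost-col i'))))

  off-top-row : ∀ {a} → rowℕ a ≢ 0 → ∀ j → top j ≢ a
  off-top-row a∉top j t≡a = a∉top (trans (sym (cong rowℕ t≡a)) (top-row j))

  rectangle-at : (a : Cell G) → Rectangle (top (col {F = G} a)) corner (rightmost (row {F = G} a)) a
  rectangle-at a = record
    { shape = shape-at (colℕ a ℕ.≟ n') (rowℕ a ℕ.≟ 0)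
    ; ab    = top-collinear _ _
    ; bc    = inj₂ (toℕ-injective (trans (toℕ-fromℕ n') (sym (rightmost-col _))))
    ; cd    = inj₁ refl
    ; da    = inj₂ refl
    }
    where
    shape-at : Dec (colℕ a ≡ n') → Dec (rowℕ a ≡ 0) →
               RectangleShape (top (col {F = G} a)) corner (rightmost (row {F = G} a)) a
    shape-at (yes on-last-col) _ = collapsed-ab
      (cell-≡ (trans (top-row _) (sym (top-row _))) (trans on-last-col (sym (toℕ-fromℕ n'))))
      (cell-≡ refl (trans on-last-col (sym (rightmost-col _))))
    shape-at (no _) (yes on-top-row) = collapsed-ad
      (cell-≡ (trans (top-row _) (sym on-top-row)) refl)
      (cell-≡ (trans (top-row _) (sym on-top-row)) (trans (toℕ-fromℕ n') (sym (rightmost-col _))))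
    shape-at (no off-last-col) (no off-top) = proper
      (λ t≡p → off-last-col (trans (cong colℕ t≡p) (toℕ-fromℕ n')))
      (off-top-row off-top _ ∘ sym)
      (off-top-row off-top _)
      (off-top-row off-top _)

module NonEmpty {m' n' m n : ℕ} (Fl : Ferrers (suc m') (suc n')) (F : Ferrers m n)
  (φ : CellMap Fl F) (φ-injective : Injective _≡_ _≡_ φ) (φ-lines : PreservesLines Fl F φ)
  where

  open Border Fl
  open Image Fl F φ φ-injective φ-lines
  private module T = Cells F

  φrow : Cell Fl → Fin m
  φrow = row {F = F} ∘ φ

  φcol : Cell Fl → Fin n
  φcol = col {F = F} ∘ φ

  top-on-line : T.OnOneRow (φ ∘ top) ⊎ T.ᵀ.OnOneRow (φ ∘ top)
  top-on-line = T.collinear-family-on-line (φ ∘ top) (top-injective ∘ φ-injective)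
                  (λ j j' → image-collinear (top-collinear j j'))

  rightmost-on-line : T.OnOneRow (φ ∘ rightmost) ⊎ T.ᵀ.OnOneRow (φ ∘ rightmost)
  rightmost-on-line = T.collinear-family-on-line (φ ∘ rightmost) (rightmost-injective ∘ φ-injective)
                        (λ i i' → image-collinear (rightmost-collinear i i'))

  image-rectangle-at : (a : Cell Fl) →
    T.Rectangle (φ (top (col {F = Fl} a))) (φ corner) (φ (rightmost (row {F = Fl} a))) (φ a)
  image-rectangle-at a = image-rectangle (rectangle-at a)

  row-from-rightmost : T.OnOneRow (φ ∘ top) → ∀ a → φrow a ≡ φrow (rightmost (row {F = Fl} a))
  row-from-rightmost on-row a = T.opposite-sides-on-rows (image-rectangle-at a) (on-row _ _)

  col-from-rightmost : T.ᵀ.OnOneRow (φ ∘ top) → ∀ a → φcol a ≡ φcol (rightmost (row {F = Fl} a))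
  col-from-rightmost on-col a =
    T.ᵀ.opposite-sides-on-rows (T.rectangle-transpose (image-rectangle-at a)) (on-col _ _)

  row-from-top : T.OnOneRow (φ ∘ rightmost) → ∀ a → φrow a ≡ φrow (top (col {F = Fl} a))
  row-from-top on-row a =
    T.opposite-sides-on-rows (T.rectangle-flip (image-rectangle-at a))
      (trans (on-row _ fzero) (cong φrow rightmost-zero≡corner))

  col-from-top : T.ᵀ.OnOneRow (φ ∘ rightmost) → ∀ a → φcol a ≡ φcol (top (col {F = Fl} a))
  col-from-top on-col a =
    T.ᵀ.opposite-sides-on-rows (T.rectangle-transpose (T.rectangle-flip (image-rectangle-at a)))
      (trans (on-col _ fzero) (cong φcol rightmost-zero≡corner))

  keepsShape-or-degenerates : KeepsShape Fl F φ ⊎ Degenerates Fl F φ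
  keepsShape-or-degenerates with top-on-line | rightmost-on-line
  ... | inj₁ top-on-row | inj₂ rightmost-on-col =
    inj₁ (inj₁ (φrow ∘ rightmost , φcol ∘ top , λ a →
      cong₂ _,_ (row-from-rightmost top-on-row a) (col-from-top rightmost-on-col a)))
  ... | inj₂ top-on-col | inj₁ rightmost-on-row =
    inj₁ (inj₂ (φcol ∘ rightmost , φrow ∘ top , λ a →
      cong₂ _,_ (row-from-top rightmost-on-row a) (col-from-rightmost top-on-col a)))
  ... | inj₁ top-on-row | inj₁ rightmost-on-row =
    inj₂ (inj₁ (φrow (rightmost fzero) , λ a →
      trans (row-from-rightmost top-on-row a) (rightmost-on-row _ fzero)))
  ... | inj₂ top-on-col | inj₂ rightmost-on-col =
    inj₂ (inj₂ (φcol (rightmost fzero) , λ a →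
      trans (col-from-rightmost top-on-col a) (rightmost-on-col _ fzero)))

keepsShape-or-degenerates : ∀ {ml nl m n} (Fl : Ferrers ml nl) (F : Ferrers m n) (φ : CellMap Fl F) →
                            Injective _≡_ _≡_ φ → PreservesLines Fl F φ →
                            KeepsShape Fl F φ ⊎ Degenerates Fl F φ
keepsShape-or-degenerates {zero} {zero} _ _ _ _ _ =
  inj₁ (inj₁ ((λ ()) , (λ ()) , λ { ((() , _) , _) }))
keepsShape-or-degenerates {zero} {suc _} Fl _ _ _ _ with row0 Fl fzero
... | () , _
keepsShape-or-degenerates {suc _} {zero} Fl _ _ _ _ with colLast Fl fzero
... | () , _
keepsShape-or-degenerates {suc _} {suc _} Fl F φ φ-injective φ-lines =
  NonEmpty.keepsShape-or-degenerates Fl F φ φ-injective φ-lines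

proposition4p2 : ∀ {m n m₁ n₁ m₂ n₂ : ℕ}
    (F : Ferrers m n) (F₁ : Ferrers m₁ n₁) (F₂ : Ferrers m₂ n₂)
    (φ₁ : CellMap F₁ F) (φ₂ : CellMap F₂ F) →
    ProperCombination F F₁ F₂ φ₁ φ₂ →
    (KeepsShape F₁ F φ₁ ⊎ Degenerates F₁ F φ₁) ×
    (KeepsShape F₂ F φ₂ ⊎ Degenerates F₂ F φ₂)
proposition4p2 F F₁ F₂ φ₁ φ₂ combination =
  keepsShape-or-degenerates F₁ F φ₁ (PC.inj₁ combination) (PC.lines₁ combination) ,
  keepsShape-or-degenerates F₂ F φ₂ (PC.inj₂ combination) (PC.lines₂ combination)
  where module PC = ProperCombination
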